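{- Let $D$ be a finite set of integers. There exists a signed tree $(T,s)$, where $T$ is a tree with at least two vertices, whose signed degree set is $D$ if and only if $1\in D$ or $-1\in D$.
   Context: A signed graph is a pair $(G,s)$ where $G$ is a finite simple graph and $s:E(G)\to\{+,-\}$. The signed degree $sdeg(v)$ of a vertex $v$ is the number of positive edges incident to $v$ minus the number of negative edges incident to $v$. $(G,s)$ realizes (satisfies) $D$ if $D=\{sdeg(v): v\in V(G)\}$. A signed tree is a signed graph whose underlying graph is a tree. -}

module Defs where

open import Data.Nat using (ℕ; _≤_)
open import Data.Integer using (ℤ; +_; -_; _+_; 0ℤ; 1ℤ)
open import Data.Fin using (Fin)
open import Data.List using (List; []; _∷_; _++_; foldr; map; length; allFin)
open import Data.List.Relation.Unary.Unique.Propositional using (Unique)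
open import Data.List.Relation.Unary.Linked using (Linked)
open import Data.List.Membership.Propositional using (_∈_)
open import Data.Product using (Σ; ∃; _×_)
open import Relation.Binary.PropositionalEquality using (_≡_; _≢_)
open import Relation.Nullary using (¬_)
open import Function.Bundles using (_⇔_)

data Label : Set where
  none pos neg : Label

record SignedGraph (n : ℕ) : Set where
  field
    lab       : Fin n → Fin n → Label
    symmetric : ∀ i j → lab i j ≡ lab j i
    loopless  : ∀ i → lab i i ≡ none
open SignedGraph public

Adj : ∀ {n} → SignedGraph n → Fin n → Fin n → Set
Adj G i j = lab G i j ≢ none

data Walk {n} (G : SignedGraph n) : Fin n → Fin n → Set where
  here : ∀ {u} → Walk G u u
  step : ∀ {u w v} → Adj G u w → Walk G w v → Walk G u v

Connected : ∀ {n} → SignedGraph n → Set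
Connected G = ∀ u v → Walk G u v

-- a cycle: distinct vertices u, v₁, …, vₖ with k ≥ 2 (so length ≥ 3),
-- consecutive ones adjacent and vₖ adjacent to u
HasCycle : ∀ {n} → SignedGraph n → Set
HasCycle {n} G = Σ (Fin n) λ u → Σ (List (Fin n)) λ vs →
  (2 ≤ length vs) × Unique (u ∷ vs) × Linked (Adj G) (u ∷ vs ++ u ∷ [])

Acyclic : ∀ {n} → SignedGraph n → Set
Acyclic G = ¬ HasCycle G

IsTree : ∀ {n} → SignedGraph n → Set
IsTree G = Connected G × Acyclic G

labVal : Label → ℤ
labVal none = 0ℤ
labVal pos  = 1ℤ
labVal neg  = - 1ℤ

sumℤ : List ℤ → ℤ
sumℤ = foldr _+_ 0ℤ

sdeg : ∀ {n} → SignedGraph n → Fin n → ℤ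
sdeg {n} G v = sumℤ (map (λ w → labVal (lab G v w)) (allFin n))

Realizes : ∀ {n} → SignedGraph n → List ℤ → Set
Realizes {n} G D = ∀ d → (d ∈ D) ⇔ (∃ λ (v : Fin n) → sdeg G v ≡ d)

-- A tree on at least two vertices has a leaf, and the signed degree of a leaf is ±1.
-- Conversely, if g = ±1 lies in D, then D is realized by a caterpillar: a spine of
-- g-edges with one vertex for each element of D. The degree of the spine vertex under
-- construction (the focus) is moved one unit at a time, either by a pendant g-edge or
-- by a cherry, a (−g)-edge to a new vertex carrying two pendant g-edges; every vertex
-- added this way has signed degree g. All trees involved are grown by adding leaves.

module Submission where

open import Defs
open import Data.Nat as ℕ using (ℕ; zero; suc; _≤_; _<_; z≤n; s≤s)
import Data.Nat.Properties as ℕ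
open import Data.Integer as ℤ using (ℤ; -[1+_]; 1ℤ; -_; 0ℤ; _+_; _-_)
import Data.Integer.Properties as ℤ
open import Algebra.Properties.AbelianGroup ℤ.+-0-abelianGroup using (//-rightDividesˡ; \\-leftDividesˡ)
open import Data.Fin as Fin using (Fin; zero; suc)
import Data.Fin.Properties as Fin
open import Data.List using (List; []; _∷_; _++_; _∷ʳ_; [_]; map; length; tabulate; lookup)
open import Data.List.Properties using (map-tabulate; tabulate-cong; ++-assoc; map-++; length-map; length-++-≤ʳ)
open import Data.List.Membership.Propositional using (_∈_; _∉_)
open import Data.List.Membership.Propositional.Properties using (∈-lookup; ∈-∃++)
open import Data.List.Relation.Unary.Any using (here; there; any?)
open import Data.List.Relation.Unary.All as All using (All; []; _∷_)
import Data.List.Relation.Unary.All.Properties as All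
open import Data.List.Relation.Unary.AllPairs using ([]; _∷_)
open import Data.List.Relation.Unary.Unique.Propositional using (Unique)
import Data.List.Relation.Unary.Unique.Propositional.Properties as Unique
open import Data.List.Relation.Unary.Linked using (Linked; []; [-]; _∷_)
import Data.List.Relation.Unary.Linked.Properties as Linked
open import Data.Product using (Σ; ∃; ∃₂; _×_; _,_)
open import Data.Sum using (_⊎_; inj₁; inj₂)
import Data.Sum as Sum
open import Data.Empty using (⊥-elim)
open import Relation.Nullary using (¬_; Dec; yes; no; ¬?)
open import Relation.Nullary.Decidable using (decidable-stable; _×-dec_)
open import Relation.Binary.PropositionalEquality using (_≡_; _≢_; refl; sym; trans; cong; subst; module ≡-Reasoning)
open import Function using (_∘_; id)
open import Function.Bundles using (_⇔_; mk⇔; Equivalence)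

module _ {A : Set} where

  Unique-∷ʳ : ∀ {x : A} {xs} → Unique (x ∷ xs) → Unique (xs ∷ʳ x)
  Unique-∷ʳ {xs = []}     _                          = [] ∷ []
  Unique-∷ʳ {xs = y ∷ ys} ((x≢y ∷ x∉ys) ∷ y∉ys ∷ U) =
    All.++⁺ y∉ys ((x≢y ∘ sym) ∷ []) ∷ Unique-∷ʳ (x∉ys ∷ U)

  Unique-++⁻ˡ : ∀ (xs : List A) {ys} → Unique (xs ++ ys) → Unique xs
  Unique-++⁻ˡ []       _       = []
  Unique-++⁻ˡ (x ∷ xs) (p ∷ U) = All.++⁻ˡ xs p ∷ Unique-++⁻ˡ xs U

  Unique-lookup-injective : ∀ {xs : List A} → Unique xs →
                            ∀ {i j} → lookup xs i ≡ lookup xs j → i ≡ j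
  Unique-lookup-injective (_ ∷ _)   {zero}  {zero}  _ = refl
  Unique-lookup-injective (x∉ ∷ _)  {zero}  {suc j} e = ⊥-elim (All.lookup x∉ (∈-lookup j) e)
  Unique-lookup-injective (x∉ ∷ _)  {suc i} {zero}  e = ⊥-elim (All.lookup x∉ (∈-lookup i) (sym e))
  Unique-lookup-injective (_ ∷ U)   {suc i} {suc j} e = cong suc (Unique-lookup-injective U e)

  module _ {R : A → A → Set} where

    Linked-∷ʳ : ∀ xs {x y} → Linked R (xs ∷ʳ x) → R x y → Linked R (xs ∷ʳ x ∷ʳ y)
    Linked-∷ʳ []           [-]      r = r ∷ [-]
    Linked-∷ʳ (_ ∷ [])     (r′ ∷ _) r = r′ ∷ r ∷ [-]
    Linked-∷ʳ (_ ∷ b ∷ xs) (r′ ∷ L) r = r′ ∷ Linked-∷ʳ (b ∷ xs) L r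

    Linked-++⁻ˡ : ∀ xs {ys} → Linked R (xs ++ ys) → Linked R xs
    Linked-++⁻ˡ []           _       = []
    Linked-++⁻ˡ (_ ∷ [])     _       = [-]
    Linked-++⁻ˡ (_ ∷ b ∷ xs) (r ∷ L) = r ∷ Linked-++⁻ˡ (b ∷ xs) L

Unique⇒length≤ : ∀ {n} {xs : List (Fin n)} → Unique xs → length xs ≤ n
Unique⇒length≤ U = Fin.injective⇒≤ (Unique-lookup-injective U)

data Sign : Set where
  plus minus : Sign

label : Sign → Label
label plus  = pos
label minus = neg

value : Sign → ℤ
value ℓ = labVal (label ℓ)

opposite : Sign → Sign
opposite plus  = minus
opposite minus = plus

label≢none : ∀ ℓ → label ℓ ≢ none
label≢none plus  ()
label≢none minus ()

value≢0 : ∀ ℓ → value ℓ ≢ 0ℤ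
value≢0 plus  ()
value≢0 minus ()

same-or-opposite : ∀ ℓ g → ℓ ≡ g ⊎ opposite ℓ ≡ g
same-or-opposite plus  plus  = inj₁ refl
same-or-opposite plus  minus = inj₂ refl
same-or-opposite minus plus  = inj₂ refl
same-or-opposite minus minus = inj₁ refl

edge-sign : ∀ {l} → l ≢ none → ∃ λ ℓ → labVal l ≡ value ℓ
edge-sign {none} l≢none = ⊥-elim (l≢none refl)
edge-sign {pos}  _      = plus , refl
edge-sign {neg}  _      = minus , refl

none-stable : ∀ {l} → ¬ (l ≢ none) → l ≡ none
none-stable {none} _ = refl
none-stable {pos}  h = ⊥-elim (h λ ())
none-stable {neg}  h = ⊥-elim (h λ ())

soleEdge : ∀ {n} → Fin n → Label → Fin n → Label
soleEdge zero    L zero    = L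
soleEdge zero    L (suc _) = none
soleEdge (suc p) L zero    = none
soleEdge (suc p) L (suc j) = soleEdge p L j

soleEdge-self : ∀ {n} (p : Fin n) L → soleEdge p L p ≡ L
soleEdge-self zero    L = refl
soleEdge-self (suc p) L = soleEdge-self p L

soleEdge-other : ∀ {n} (p : Fin n) L {j} → j ≢ p → soleEdge p L j ≡ none
soleEdge-other zero    L {zero}  j≢p = ⊥-elim (j≢p refl)
soleEdge-other zero    L {suc j} _   = refl
soleEdge-other (suc p) L {zero}  _   = refl
soleEdge-other (suc p) L {suc j} j≢p = soleEdge-other p L (j≢p ∘ cong suc)

soleEdge-support : ∀ {n} (p : Fin n) L {j} → soleEdge p L j ≢ none → j ≡ p
soleEdge-support p L {j} e with j Fin.≟ p
... | yes j≡p = j≡p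
... | no  j≢p = ⊥-elim (e (soleEdge-other p L j≢p))

sumℤ-zeros : ∀ n → sumℤ (tabulate {n = n} λ _ → 0ℤ) ≡ 0ℤ
sumℤ-zeros zero    = refl
sumℤ-zeros (suc n) = cong (0ℤ +_) (sumℤ-zeros n)

sumℤ-soleEdge : ∀ {n} (p : Fin n) L → sumℤ (tabulate (labVal ∘ soleEdge p L)) ≡ labVal L
sumℤ-soleEdge {suc n} zero    L = trans (cong (labVal L +_) (sumℤ-zeros n)) (ℤ.+-identityʳ _)
sumℤ-soleEdge         (suc p) L = trans (ℤ.+-identityˡ _) (sumℤ-soleEdge p L)

sdeg-tabulate : ∀ {n} (G : SignedGraph n) v → sdeg G v ≡ sumℤ (tabulate (labVal ∘ lab G v))
sdeg-tabulate G v = cong sumℤ (map-tabulate id (labVal ∘ lab G v))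

sdeg-soleEdge : ∀ {n} (G : SignedGraph n) {v} p L → (∀ w → lab G v w ≡ soleEdge p L w) →
                sdeg G v ≡ labVal L
sdeg-soleEdge G {v} p L row = begin
  sdeg G v                                   ≡⟨ sdeg-tabulate G v ⟩
  sumℤ (tabulate (labVal ∘ lab G v))         ≡⟨ cong sumℤ (tabulate-cong (cong labVal ∘ row)) ⟩
  sumℤ (tabulate (labVal ∘ soleEdge p L))    ≡⟨ sumℤ-soleEdge p L ⟩
  labVal L                                   ∎
  where open ≡-Reasoning

sdeg≢0⇒2≤order : ∀ {n} (G : SignedGraph n) v → sdeg G v ≢ 0ℤ → 2 ≤ n
sdeg≢0⇒2≤order {suc zero}    G zero    sdeg≢0 = ⊥-elim (sdeg≢0 (cong (λ l → labVal l + 0ℤ) (loopless G zero)))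
sdeg≢0⇒2≤order {suc (suc _)} G _       _      = s≤s (s≤s z≤n)

-- Adding a leaf

-- The new leaf is vertex zero, the old vertex i becomes suc i.
addLeaf : ∀ {n} → SignedGraph n → Fin n → Label → SignedGraph (suc n)
addLeaf {n} G p L = record { lab = pair ; symmetric = pair-sym ; loopless = pair-loopless }
  where
  pair : Fin (suc n) → Fin (suc n) → Label
  pair zero    j       = soleEdge (suc p) L j
  pair (suc i) zero    = soleEdge p L i
  pair (suc i) (suc j) = lab G i j

  pair-sym : ∀ i j → pair i j ≡ pair j i
  pair-sym zero    zero    = refl
  pair-sym zero    (suc j) = refl
  pair-sym (suc i) zero    = refl
  pair-sym (suc i) (suc j) = symmetric G i j

  pair-loopless : ∀ i → pair i i ≡ none
  pair-loopless zero    = refl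
  pair-loopless (suc i) = loopless G i

module _ {n} (G : SignedGraph n) (p : Fin n) (L : Label) where

  sdeg-addLeaf-leaf : sdeg (addLeaf G p L) zero ≡ labVal L
  sdeg-addLeaf-leaf = sdeg-soleEdge (addLeaf G p L) {zero} (suc p) L (λ _ → refl)

  sdeg-addLeaf-old : ∀ i → sdeg (addLeaf G p L) (suc i) ≡ labVal (soleEdge p L i) + sdeg G i
  sdeg-addLeaf-old i =
    trans (sdeg-tabulate (addLeaf G p L) (suc i)) (cong (labVal (soleEdge p L i) +_) (sym (sdeg-tabulate G i)))

  sdeg-addLeaf-parent : sdeg (addLeaf G p L) (suc p) ≡ labVal L + sdeg G p
  sdeg-addLeaf-parent = trans (sdeg-addLeaf-old p) (cong (λ l → labVal l + sdeg G p) (soleEdge-self p L))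

  sdeg-addLeaf-other : ∀ i → i ≢ p → sdeg (addLeaf G p L) (suc i) ≡ sdeg G i
  sdeg-addLeaf-other i i≢p =
    trans (sdeg-addLeaf-old i) (trans (cong (λ l → labVal l + sdeg G i) (soleEdge-other p L i≢p)) (ℤ.+-identityˡ _))

-- Trees

Adj-sym : ∀ {n} (G : SignedGraph n) {i j} → Adj G i j → Adj G j i
Adj-sym G {i} {j} a e = a (trans (symmetric G i j) e)

Adj? : ∀ {n} (G : SignedGraph n) i j → Dec (Adj G i j)
Adj? G i j with lab G i j
... | none = no λ a → a refl
... | pos  = yes λ ()
... | neg  = yes λ ()

module _ {n} {G : SignedGraph n} where

  _++ʷ_ : ∀ {u v w} → Walk G u v → Walk G v w → Walk G u w
  here       ++ʷ q = q
  step a p   ++ʷ q = step a (p ++ʷ q)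

  reverseʷ : ∀ {u v} → Walk G u v → Walk G v u
  reverseʷ here       = here
  reverseʷ (step a p) = reverseʷ p ++ʷ step (Adj-sym G a) here

IsCycle : ∀ {n} → SignedGraph n → Fin n → List (Fin n) → Set
IsCycle G u vs = (2 ≤ length vs) × Unique (u ∷ vs) × Linked (Adj G) (u ∷ vs ++ u ∷ [])

module _ {n} (G : SignedGraph n) where

  rotate : ∀ {u v vs} → IsCycle G u (v ∷ vs) → IsCycle G v (vs ∷ʳ u)
  rotate {vs = []}     (s≤s () , _)
  rotate {u} {v} {vs = w ∷ ws} (_ , U , uv ∷ L) =
    s≤s (length-++-≤ʳ [ u ] {ws}) , Unique-∷ʳ U , Linked-∷ʳ (v ∷ w ∷ ws) L uv

  rotate-to : ∀ {u x bs} as → IsCycle G u (as ++ x ∷ bs) → ∃₂ λ u′ ws → IsCycle G u′ (x ∷ ws)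
  rotate-to                []       c = _ , _ , c
  rotate-to {u} {x} {bs}   (a ∷ as) c =
    rotate-to as (subst (IsCycle G a) (++-assoc as (x ∷ bs) [ u ]) (rotate c))

  on-cycle : ∀ {x u vs} → x ∈ u ∷ vs → IsCycle G u vs → ∃₂ λ u′ ws → IsCycle G u′ (x ∷ ws)
  on-cycle {vs = []}     _          (() , _)
  on-cycle {vs = v ∷ vs} (here refl) c = rotate-to vs (rotate c)
  on-cycle               (there x∈vs) c with as , bs , refl ← ∈-∃++ x∈vs = rotate-to as c

module _ {n} (G : SignedGraph n) (p : Fin n) (L : Label) where

  private
    H = addLeaf G p L

  leaf-neighbour : ∀ {w} → Adj H zero w → w ≡ suc p
  leaf-neighbour = soleEdge-support (suc p) L

  lift-walk : ∀ {u v} → Walk G u v → Walk H (suc u) (suc v)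
  lift-walk here       = here
  lift-walk (step a w) = step a (lift-walk w)

  addLeaf-connected : L ≢ none → Connected G → Connected H
  addLeaf-connected L≢none conn u v = reverseʷ (from-leaf u) ++ʷ from-leaf v
    where
    from-leaf : ∀ v → Walk H zero v
    from-leaf zero    = here
    from-leaf (suc v) = step {w = suc p} (L≢none ∘ trans (sym (soleEdge-self p L))) (lift-walk (conn p v))

  -- A leaf has a single neighbour, so it cannot lie between two distinct cycle vertices.
  leaf-off-cycle : ∀ {u ws} → ¬ IsCycle H u (zero ∷ ws)
  leaf-off-cycle {ws = []}    (s≤s () , _)
  leaf-off-cycle {u} {w ∷ _} (_ , (u∉ ∷ _) , uz ∷ zw ∷ _) =
    All.lookup u∉ (there (here refl)) (trans (leaf-neighbour (Adj-sym H {u} uz)) (sym (leaf-neighbour zw)))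

  unlift : ∀ (xs : List (Fin (suc n))) → zero ∉ xs → ∃ λ ys → xs ≡ map suc ys
  unlift []           _     = [] , refl
  unlift (zero ∷ xs)  zero∉ = ⊥-elim (zero∉ (here refl))
  unlift (suc y ∷ xs) zero∉ with ys , refl ← unlift xs (zero∉ ∘ there) = y ∷ ys , refl

  lower-cycle : ∀ {u vs} → zero ∉ u ∷ vs → IsCycle H u vs → HasCycle G
  lower-cycle {u} {vs} zero∉ (len , U , L) with unlift (u ∷ vs) zero∉
  ... | u′ ∷ vs′ , refl =
    u′ , vs′ , subst (2 ≤_) (length-map suc vs′) len , Unique.map⁻ U ,
    Linked.map⁻ (subst (Linked (Adj H)) (sym (map-++ suc (u′ ∷ vs′) [ u′ ])) L)

  addLeaf-acyclic : Acyclic G → Acyclic H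
  addLeaf-acyclic acyclic (u , vs , c) with any? (zero Fin.≟_) (u ∷ vs)
  ... | yes zero∈ = let _ , _ , c′ = on-cycle H zero∈ c in leaf-off-cycle c′
  ... | no  zero∉ = acyclic (lower-cycle zero∉ c)

  addLeaf-isTree : L ≢ none → IsTree G → IsTree H
  addLeaf-isTree L≢none (conn , acyclic) = addLeaf-connected L≢none conn , addLeaf-acyclic acyclic

point : SignedGraph 1
point = record { lab = λ _ _ → none ; symmetric = λ _ _ → refl ; loopless = λ _ → refl }

point-isTree : IsTree point
point-isTree = connected , acyclic
  where
  connected : Connected point
  connected zero zero = here

  acyclic : Acyclic point
  acyclic (_ , []    , _ , _ , a ∷ _) = a refl
  acyclic (_ , _ ∷ _ , _ , _ , a ∷ _) = a refl

-- Leaves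

module _ {n} (G : SignedGraph n) where

  IsLeaf : Fin n → Fin n → Set
  IsLeaf x y = Adj G x y × (∀ z → Adj G x z → z ≡ y)

  sdeg-leaf : ∀ {x y} → IsLeaf x y → ∃ λ ℓ → sdeg G x ≡ value ℓ
  sdeg-leaf {x} {y} (xy , only) =
    let ℓ , e = edge-sign xy in ℓ , trans (sdeg-soleEdge G y (lab G x y) row) e
    where
    row : ∀ w → lab G x w ≡ soleEdge y (lab G x y) w
    row w with w Fin.≟ y
    ... | yes refl = sym (soleEdge-self y _)
    ... | no  w≢y  = trans (none-stable (w≢y ∘ only w)) (sym (soleEdge-other y _ w≢y))

  module _ (acyclic : Acyclic G) where

    chord⇒cycle : ∀ {x y rest z} → Unique (x ∷ y ∷ rest) → Linked (Adj G) (x ∷ y ∷ rest) →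
                  z ∈ rest → Adj G x z → HasCycle G
    chord⇒cycle {x} {y} {z = z} U L z∈rest xz with as , bs , refl ← ∈-∃++ z∈rest =
      x , y ∷ as ∷ʳ z , s≤s (length-++-≤ʳ [ z ] {as}) ,
      Unique-++⁻ˡ (x ∷ y ∷ as ∷ʳ z) (subst Unique path≡ U) ,
      Linked-∷ʳ (x ∷ y ∷ as) (Linked-++⁻ˡ (x ∷ y ∷ as ∷ʳ z) (subst (Linked (Adj G)) path≡ L)) (Adj-sym G xz)
      where
      path≡ : x ∷ y ∷ as ++ z ∷ bs ≡ (x ∷ y ∷ as ∷ʳ z) ++ bs
      path≡ = cong (λ l → x ∷ y ∷ l) (sym (++-assoc as [ z ] bs))

    leaf-or-longer : ∀ {x y rest} → Unique (x ∷ y ∷ rest) → Linked (Adj G) (x ∷ y ∷ rest) →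
                     IsLeaf x y ⊎ ∃ λ z → Adj G x z × z ∉ x ∷ y ∷ rest
    leaf-or-longer {x} {y} {rest} U L@(xy ∷ _)
      with Fin.any? (λ z → ¬? (z Fin.≟ y) ×-dec Adj? G x z)
    ... | no  ∄z = inj₁ (xy , λ z xz → decidable-stable (z Fin.≟ y) (λ z≢y → ∄z (z , z≢y , xz)))
    ... | yes (z , z≢y , xz) with any? (z Fin.≟_) (x ∷ y ∷ rest)
    ...   | no  z∉                    = inj₂ (z , xz , z∉)
    ...   | yes (here refl)           = ⊥-elim (xz (loopless G x))
    ...   | yes (there (here z≡y))    = ⊥-elim (z≢y z≡y)
    ...   | yes (there (there z∈rest)) = ⊥-elim (acyclic (chord⇒cycle U L z∈rest xz))

    -- The fuel k suffices because a path has at most n vertices.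
    grow-path : ∀ k {x y rest} → n < length (x ∷ y ∷ rest) ℕ.+ k →
                Unique (x ∷ y ∷ rest) → Linked (Adj G) (x ∷ y ∷ rest) → ∃₂ IsLeaf
    grow-path zero    n<len U L =
      ⊥-elim (ℕ.<⇒≱ (subst (n <_) (ℕ.+-identityʳ _) n<len) (Unique⇒length≤ U))
    grow-path (suc k) {x} {y} {rest} n<len U L with leaf-or-longer U L
    ... | inj₁ leaf          = x , y , leaf
    ... | inj₂ (z , xz , z∉) = grow-path k (subst (n <_) (ℕ.+-suc _ k) n<len)
                                 (All.tabulate (λ z∈ z≡ → z∉ (subst (_∈ _) (sym z≡) z∈)) ∷ U)
                                 (Adj-sym G xz ∷ L)

    leaf-exists : 2 ≤ n → Connected G → ∃₂ IsLeaf
    leaf-exists (s≤s (s≤s _)) conn with conn zero (suc zero)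
    ... | step {w = w} zero-w _ =
      grow-path n (s≤s (ℕ.n≤1+n _)) ((w≢zero ∷ []) ∷ [] ∷ []) (Adj-sym G zero-w ∷ [-])
      where
      w≢zero : w ≢ zero
      w≢zero refl = zero-w (loopless G zero)

-- Caterpillars

record Rooted : Set where
  constructor rooted
  field
    size   : ℕ
    graph  : SignedGraph size
    isTree : IsTree graph
    focus  : Fin size
open Rooted

focusDegree : Rooted → ℤ
focusDegree s = sdeg (graph s) (focus s)

sprout : Sign → Rooted → Rooted
sprout ℓ (rooted n G t c) = rooted (suc n) (addLeaf G c (label ℓ)) (addLeaf-isTree G c _ (label≢none ℓ) t) (suc c)

extend : Sign → Rooted → Rooted
extend ℓ (rooted n G t c) = rooted (suc n) (addLeaf G c (label ℓ)) (addLeaf-isTree G c _ (label≢none ℓ) t) zero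

-- An ℓ-edge to a new vertex carrying two leaves of the opposite sign: it shifts
-- the focus degree by ℓ, while all three new vertices get the opposite degree.
cherry : Sign → Rooted → Rooted
cherry ℓ s = record (sprout (opposite ℓ) (sprout (opposite ℓ) (extend ℓ s))) { focus = suc (suc (suc (focus s))) }

module _ (ℓ : Sign) {n} (G : SignedGraph n) (c : Fin n) where

  private
    o  = label (opposite ℓ)
    G₁ = addLeaf G c (label ℓ)
    G₂ = addLeaf G₁ zero o
    G₃ = addLeaf G₂ (suc zero) o

  sdeg-cherry-root : sdeg G₃ (suc (suc (suc c))) ≡ value ℓ + sdeg G c
  sdeg-cherry-root =
    trans (sdeg-addLeaf-other G₂ (suc zero) o (suc (suc c)) (λ ()))
      (trans (sdeg-addLeaf-other G₁ zero o (suc c) (λ ())) (sdeg-addLeaf-parent G c (label ℓ)))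

  sdeg-cherry-other : ∀ v → v ≢ c → sdeg G₃ (suc (suc (suc v))) ≡ sdeg G v
  sdeg-cherry-other v v≢c =
    trans (sdeg-addLeaf-other G₂ (suc zero) o (suc (suc v)) (λ ()))
      (trans (sdeg-addLeaf-other G₁ zero o (suc v) (λ ())) (sdeg-addLeaf-other G c (label ℓ) v v≢c))

  sdeg-cherry-leaf₁ : sdeg G₃ zero ≡ value (opposite ℓ)
  sdeg-cherry-leaf₁ = sdeg-addLeaf-leaf G₂ (suc zero) o

  sdeg-cherry-leaf₂ : sdeg G₃ (suc zero) ≡ value (opposite ℓ)
  sdeg-cherry-leaf₂ = trans (sdeg-addLeaf-other G₂ (suc zero) o zero (λ ())) (sdeg-addLeaf-leaf G₁ zero o)

  sdeg-cherry-centre : sdeg G₃ (suc (suc zero)) ≡ value (opposite ℓ)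
  sdeg-cherry-centre = begin
    sdeg G₃ (suc (suc zero))                       ≡⟨ sdeg-addLeaf-parent G₂ (suc zero) o ⟩
    value ℓ′ + sdeg G₂ (suc zero)                  ≡⟨ cong (value ℓ′ +_) (sdeg-addLeaf-parent G₁ zero o) ⟩
    value ℓ′ + (value ℓ′ + sdeg G₁ zero)           ≡⟨ cong (λ x → value ℓ′ + (value ℓ′ + x)) (sdeg-addLeaf-leaf G c (label ℓ)) ⟩
    value ℓ′ + (value ℓ′ + value ℓ)                ≡⟨ two-opposites-and-one ℓ ⟩
    value ℓ′                                       ∎
    where
    open ≡-Reasoning
    ℓ′ = opposite ℓ
    two-opposites-and-one : ∀ ℓ → value (opposite ℓ) + (value (opposite ℓ) + value ℓ) ≡ value (opposite ℓ)
    two-opposites-and-one plus  = refl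
    two-opposites-and-one minus = refl

focusDegree-sprout : ∀ ℓ s → focusDegree (sprout ℓ s) ≡ value ℓ + focusDegree s
focusDegree-sprout ℓ (rooted _ G _ c) = sdeg-addLeaf-parent G c (label ℓ)

focusDegree-cherry : ∀ ℓ s → focusDegree (cherry ℓ s) ≡ value ℓ + focusDegree s
focusDegree-cherry ℓ (rooted _ G _ c) = sdeg-cherry-root ℓ G c

record Embedding (s s′ : Rooted) : Set where
  field
    embed           : Fin (size s) → Fin (size s′)
    embed-off-focus : ∀ {v} → v ≢ focus s → embed v ≢ focus s′
    sdeg-embed      : ∀ {v} → v ≢ focus s → sdeg (graph s′) (embed v) ≡ sdeg (graph s) v

sprout-embedding : ∀ ℓ s → Embedding s (sprout ℓ s)
sprout-embedding ℓ (rooted _ G _ c) = record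
  { embed = suc ; embed-off-focus = λ v≢c → v≢c ∘ Fin.suc-injective ; sdeg-embed = sdeg-addLeaf-other G c _ _ }

extend-embedding : ∀ ℓ s → Embedding s (extend ℓ s)
extend-embedding ℓ (rooted _ G _ c) = record
  { embed = suc ; embed-off-focus = λ _ () ; sdeg-embed = sdeg-addLeaf-other G c _ _ }

cherry-embedding : ∀ ℓ s → Embedding s (cherry ℓ s)
cherry-embedding ℓ (rooted _ G _ c) = record
  { embed           = λ v → suc (suc (suc v))
  ; embed-off-focus = λ v≢c → v≢c ∘ Fin.suc-injective ∘ Fin.suc-injective ∘ Fin.suc-injective
  ; sdeg-embed      = sdeg-cherry-other ℓ G c _
  }

TreeRealizable : List ℤ → Set
TreeRealizable D = Σ ℕ λ n → (2 ≤ n) × Σ (SignedGraph n) λ T → IsTree T × Realizes T D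

module Caterpillar (D : List ℤ) (g : Sign) (g∈D : value g ∈ D) where

  Attained : Rooted → ℤ → Set
  Attained s d = ∃ λ v → v ≢ focus s × sdeg (graph s) v ≡ d

  -- R lists the elements of D still to be realized.
  record Valid (R : List ℤ) (s : Rooted) : Set where
    field
      off-focus : ∀ v → v ≢ focus s → sdeg (graph s) v ∈ D
      covers    : ∀ d → d ∈ D → d ∈ R ⊎ Attained s d
  open Valid

  module _ {s s′} (E : Embedding s s′) where
    open Embedding E

    attained-embed : ∀ {d} → Attained s d → Attained s′ d
    attained-embed (v , v≢c , e) = embed v , embed-off-focus v≢c , trans (sdeg-embed v≢c) e

    off-focus-embed : ∀ {R} → Valid R s → ∀ {v} → v ≢ focus s → sdeg (graph s′) (embed v) ∈ D
    off-focus-embed V {v} v≢c = subst (_∈ D) (sym (sdeg-embed v≢c)) (off-focus V v v≢c)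

    covers-embed : ∀ {R} → Valid R s → ∀ d → d ∈ D → d ∈ R ⊎ Attained s′ d
    covers-embed V d = Sum.map₂ attained-embed ∘ covers V d

  sprout-valid : ∀ {R} s → Valid R s → Valid R (sprout g s)
  sprout-valid s@(rooted _ G _ c) V = record { off-focus = off ; covers = covers-embed E V }
    where
    E = sprout-embedding g s
    off : ∀ v → v ≢ suc c → sdeg (addLeaf G c (label g)) v ∈ D
    off zero    _       = subst (_∈ D) (sym (sdeg-addLeaf-leaf G c (label g))) g∈D
    off (suc v) sv≢sc   = off-focus-embed E V (sv≢sc ∘ cong suc)

  cherry-valid : ∀ {R} ℓ → opposite ℓ ≡ g → ∀ s → Valid R s → Valid R (cherry ℓ s)
  cherry-valid ℓ refl s@(rooted _ G _ c) V = record { off-focus = off ; covers = covers-embed E V }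
    where
    E = cherry-embedding ℓ s
    new : ∀ {v} → sdeg (graph (cherry ℓ s)) v ≡ value g → sdeg (graph (cherry ℓ s)) v ∈ D
    new e = subst (_∈ D) (sym e) g∈D
    off : ∀ v → v ≢ focus (cherry ℓ s) → sdeg (graph (cherry ℓ s)) v ∈ D
    off zero                _ = new {zero} (sdeg-cherry-leaf₁ ℓ G c)
    off (suc zero)          _ = new {suc zero} (sdeg-cherry-leaf₂ ℓ G c)
    off (suc (suc zero))    _ = new {suc (suc zero)} (sdeg-cherry-centre ℓ G c)
    off (suc (suc (suc v))) v≢c = off-focus-embed E V (v≢c ∘ cong (λ w → suc (suc (suc w))))

  nudge : Sign → Rooted → Rooted
  nudge ℓ s with same-or-opposite ℓ g
  ... | inj₁ _ = sprout ℓ s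
  ... | inj₂ _ = cherry ℓ s

  nudge-valid : ∀ {R} ℓ s → Valid R s → Valid R (nudge ℓ s)
  nudge-valid ℓ s V with same-or-opposite ℓ g
  ... | inj₁ refl = sprout-valid s V
  ... | inj₂ o≡g  = cherry-valid ℓ o≡g s V

  focusDegree-nudge : ∀ ℓ s → focusDegree (nudge ℓ s) ≡ value ℓ + focusDegree s
  focusDegree-nudge ℓ s with same-or-opposite ℓ g
  ... | inj₁ _ = focusDegree-sprout ℓ s
  ... | inj₂ _ = focusDegree-cherry ℓ s

  shift : ℤ → Rooted → Rooted
  shift (ℤ.+ zero)     s = s
  shift (ℤ.+ suc k)    s = nudge plus (shift (ℤ.+ k) s)
  shift -[1+ zero ]    s = nudge minus s
  shift -[1+ suc k ]   s = nudge minus (shift -[1+ k ] s)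

  shift-valid : ∀ {R} δ s → Valid R s → Valid R (shift δ s)
  shift-valid (ℤ.+ zero)   s V = V
  shift-valid (ℤ.+ suc k)  s V = nudge-valid plus _ (shift-valid (ℤ.+ k) s V)
  shift-valid -[1+ zero ]  s V = nudge-valid minus s V
  shift-valid -[1+ suc k ] s V = nudge-valid minus _ (shift-valid -[1+ k ] s V)

  focusDegree-shift : ∀ δ s → focusDegree (shift δ s) ≡ δ + focusDegree s
  focusDegree-shift (ℤ.+ zero)   s = sym (ℤ.+-identityˡ _)
  focusDegree-shift (ℤ.+ suc k)  s =
    trans (focusDegree-nudge plus _)
      (trans (cong (1ℤ +_) (focusDegree-shift (ℤ.+ k) s)) (sym (ℤ.+-assoc 1ℤ (ℤ.+ k) (focusDegree s))))
  focusDegree-shift -[1+ zero ]  s = focusDegree-nudge minus s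
  focusDegree-shift -[1+ suc k ] s =
    trans (focusDegree-nudge minus _)
      (trans (cong (- 1ℤ +_) (focusDegree-shift -[1+ k ] s)) (sym (ℤ.+-assoc (- 1ℤ) -[1+ k ] (focusDegree s))))

  retarget : ℤ → Rooted → Rooted
  retarget t s = shift (t - focusDegree s) s

  retarget-valid : ∀ {R} t s → Valid R s → Valid R (retarget t s)
  retarget-valid t s = shift-valid (t - focusDegree s) s

  focusDegree-retarget : ∀ t s → focusDegree (retarget t s) ≡ t
  focusDegree-retarget t s = trans (focusDegree-shift (t - focusDegree s) s) (//-rightDividesˡ (focusDegree s) t)

  extend-valid : ∀ {d R} s → Valid (d ∷ R) s → value g + focusDegree s ≡ d → d ∈ D → Valid R (extend g s)
  extend-valid {d} s@(rooted _ G _ c) V e d∈D = record { off-focus = off ; covers = cov }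
    where
    E = extend-embedding g s
    parent : sdeg (addLeaf G c (label g)) (suc c) ≡ d
    parent = trans (sdeg-addLeaf-parent G c (label g)) e
    off : ∀ v → v ≢ zero → sdeg (addLeaf G c (label g)) v ∈ D
    off zero    z≢z = ⊥-elim (z≢z refl)
    off (suc v) _   with v Fin.≟ c
    ... | yes refl = subst (_∈ D) (sym parent) d∈D
    ... | no  v≢c  = off-focus-embed E V v≢c
    cov : ∀ d′ → d′ ∈ D → d′ ∈ _ ⊎ Attained (extend g s) d′
    cov d′ d′∈D with covers V d′ d′∈D
    ... | inj₁ (here refl)      = inj₂ (suc c , (λ ()) , parent)
    ... | inj₁ (there d′∈R)     = inj₁ d′∈R
    ... | inj₂ attained         = inj₂ (attained-embed E attained)

  spine : List ℤ → Rooted → Rooted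
  spine []      s = s
  spine (d ∷ R) s = spine R (extend g (retarget (- value g + d) s))

  spine-valid : ∀ {R} s → All (_∈ D) R → Valid R s → Valid [] (spine R s)
  spine-valid             s []            V = V
  spine-valid {R = d ∷ _} s (d∈D ∷ R⊆D) V =
    spine-valid _ R⊆D (extend-valid s′ (retarget-valid (- value g + d) s V) attaches d∈D)
    where
    s′ = retarget (- value g + d) s
    attaches : value g + focusDegree s′ ≡ d
    attaches = trans (cong (value g +_) (focusDegree-retarget _ s)) (\\-leftDividesˡ (value g) d)

  valid-realizes : ∀ s → Valid [] s → focusDegree s ∈ D → Realizes (graph s) D
  valid-realizes s V focus∈D d = mk⇔ attained in-D
    where
    attained : d ∈ D → ∃ λ v → sdeg (graph s) v ≡ d
    attained d∈D with covers V d d∈D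
    ... | inj₂ (v , _ , e) = v , e
    in-D : (∃ λ v → sdeg (graph s) v ≡ d) → d ∈ D
    in-D (v , e) with v Fin.≟ focus s
    ... | yes refl = subst (_∈ D) e focus∈D
    ... | no  v≢c  = subst (_∈ D) e (off-focus V v v≢c)

  start : Rooted
  start = rooted 1 point point-isTree zero

  start-valid : Valid D start
  start-valid = record { off-focus = λ { zero z≢z → ⊥-elim (z≢z refl) } ; covers = λ _ → inj₁ }

  caterpillar : Rooted
  caterpillar = retarget (value g) (spine D start)

  focusDegree-caterpillar : focusDegree caterpillar ≡ value g
  focusDegree-caterpillar = focusDegree-retarget (value g) _

  caterpillar-valid : Valid [] caterpillar
  caterpillar-valid = retarget-valid (value g) _ (spine-valid _ (All.tabulate id) start-valid)

  realization : TreeRealizable D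
  realization =
    size caterpillar ,
    sdeg≢0⇒2≤order (graph caterpillar) (focus caterpillar) (value≢0 g ∘ trans (sym focusDegree-caterpillar)) ,
    graph caterpillar , isTree caterpillar ,
    valid-realizes caterpillar caterpillar-valid (subst (_∈ D) (sym focusDegree-caterpillar) g∈D)

realizable⇒±1∈ : ∀ {D} → TreeRealizable D → (1ℤ ∈ D) ⊎ ((- 1ℤ) ∈ D)
realizable⇒±1∈ (_ , 2≤n , T , (conn , acyclic) , realizes)
  with x , _ , leaf ← leaf-exists T acyclic 2≤n conn
  with sdeg-leaf T leaf
... | plus  , e = inj₁ (Equivalence.from (realizes _) (x , e))
... | minus , e = inj₂ (Equivalence.from (realizes _) (x , e))

±1∈⇒realizable : ∀ {D} → (1ℤ ∈ D) ⊎ ((- 1ℤ) ∈ D) → TreeRealizable D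
±1∈⇒realizable (inj₁ 1∈D)  = Caterpillar.realization _ plus 1∈D
±1∈⇒realizable (inj₂ -1∈D) = Caterpillar.realization _ minus -1∈D

mainTheorem1 : (D : List ℤ) →
    (Σ ℕ λ n → (2 ≤ n) × Σ (SignedGraph n) λ T → IsTree T × Realizes T D)
      ⇔ ((1ℤ ∈ D) ⊎ ((- 1ℤ) ∈ D))
mainTheorem1 D = mk⇔ realizable⇒±1∈ ±1∈⇒realizable
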